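{- Let $m,n$ be positive integers with $s(m+n)=s(m)+s(n)$, where for a positive integer $k$, $s(k)=\sum_{i\geqslant 1}\lfloor k/2^i\rfloor$. If $m\leqslant n$ and $\lfloor m/2^i\rfloor\neq 0$ for some integer $i\geqslant 1$, then $\lfloor n/2^{i+1}\rfloor\neq 0$. In particular, $m<n$, and $n\geqslant 2^t$ for every positive integer $t$ with $\lfloor (m+n)/2^t\rfloor\neq 0$.
   Context: $\lfloor x\rfloor$ denotes the largest integer not exceeding $x$; $2^{s(k)}$ is the $2$-part of $k!$. -}

module Defs where

open import Data.Nat using (ℕ; zero; suc; _+_; _/_; _^_)
open import Data.Nat.Properties using (m^n≢0)

floorDiv2^ : ℕ → ℕ → ℕ
floorDiv2^ k i = _/_ k (2 ^ i) {{m^n≢0 2 i}}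

sumFloor : ℕ → ℕ → ℕ
sumFloor k zero    = 0
sumFloor k (suc b) = floorDiv2^ k (suc b) + sumFloor k b

-- s(k) = Σ_{i≥1} ⌊k/2^i⌋.  Terms with i > k vanish (2^i > i > k),
-- so summing i = 1..k gives the full (finite) sum.
s : ℕ → ℕ
s k = sumFloor k k

-- s(m + n) − s(m) − s(n) is a sum of nonnegative terms ⌊(m+n)/2^i⌋ − ⌊m/2^i⌋ − ⌊n/2^i⌋,
-- so the hypothesis forces ⌊(m+n)/2^i⌋ = ⌊m/2^i⌋ + ⌊n/2^i⌋ for every i ≥ 1: adding m and n
-- produces no carry.  In particular m, n < 2^i implies m + n < 2^i.  If 2^i ≤ m ≤ n < 2^(i+1)
-- then 2^(i+1) ≤ m + n < 2^(i+1), which is absurd; the remaining claims follow the same way.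
module Submission where

open import Defs
open import Data.Nat using (ℕ; zero; suc; _+_; _*_; _^_; _/_; _≤_; _<_; _≥_; z≤n; s≤s; _<?_; _≤?_; NonZero)
open import Data.Nat.Properties
open import Data.Nat.DivMod using (m<n⇒m/n≡0; m/n≡0⇒m<n; m/n*n≤m; m*n/n≡m; /-monoˡ-≤)
open import Data.Product using (_×_; _,_; ∃-syntax)
open import Data.Sum using (inj₁; inj₂)
open import Relation.Nullary using (yes; no; contradiction)
open import Relation.Binary.PropositionalEquality using (_≡_; _≢_; refl; sym; trans; cong; cong₂; subst)
open import Data.Nat.Solver using (module +-*-Solver)
open +-*-Solver using (solve; _:+_; _:=_)

2^[1+n]≡2^n+2^n : ∀ n → 2 ^ suc n ≡ 2 ^ n + 2 ^ n
2^[1+n]≡2^n+2^n n = cong (2 ^ n +_) (+-identityʳ (2 ^ n))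

n<2^n : ∀ n → n < 2 ^ n
n<2^n zero    = s≤s z≤n
n<2^n (suc n) rewrite 2^[1+n]≡2^n+2^n n = +-mono-≤ (m^n>0 2 n) (n<2^n n)

binary-magnitude : ∀ k → 1 ≤ k → ∃[ t ] 2 ^ t ≤ k × k < 2 ^ suc t
binary-magnitude (suc zero)    _ = 0 , ≤-refl , s≤s (s≤s z≤n)
binary-magnitude (suc (suc k)) _ with binary-magnitude (suc k) (s≤s z≤n)
... | t , lo , hi with m≤n⇒m<n∨m≡n hi
...   | inj₁ lt  = t , m≤n⇒m≤1+n lo , lt
...   | inj₂ 2+k≡2^[1+t] = suc t , ≤-reflexive (sym 2+k≡2^[1+t]) ,
        subst (_< 2 ^ suc (suc t)) (sym 2+k≡2^[1+t]) (^-monoʳ-< 2 (s≤s (s≤s z≤n)) (n<1+n (suc t)))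

/-superadditive : ∀ a b d .{{_ : NonZero d}} → a / d + b / d ≤ (a + b) / d
/-superadditive a b d = begin
  a / d + b / d              ≡⟨ sym (m*n/n≡m (a / d + b / d) d) ⟩
  (a / d + b / d) * d / d    ≤⟨ /-monoˡ-≤ d quotients≤ ⟩
  (a + b) / d                ∎
  where
  open ≤-Reasoning
  quotients≤ : (a / d + b / d) * d ≤ a + b
  quotients≤ rewrite *-distribʳ-+ d (a / d) (b / d) = +-mono-≤ (m/n*n≤m a d) (m/n*n≤m b d)

floorDiv2^-superadditive : ∀ a b i → floorDiv2^ a i + floorDiv2^ b i ≤ floorDiv2^ (a + b) i
floorDiv2^-superadditive a b i = /-superadditive a b (2 ^ i) {{m^n≢0 2 i}}

<⇒floorDiv2^≡0 : ∀ {k} i → k < 2 ^ i → floorDiv2^ k i ≡ 0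
<⇒floorDiv2^≡0 i = m<n⇒m/n≡0 {{m^n≢0 2 i}}

floorDiv2^≡0⇒< : ∀ {k} i → floorDiv2^ k i ≡ 0 → k < 2 ^ i
floorDiv2^≡0⇒< i = m/n≡0⇒m<n {{m^n≢0 2 i}}

floorDiv2^≢0⇒2^≤ : ∀ {k} i → floorDiv2^ k i ≢ 0 → 2 ^ i ≤ k
floorDiv2^≢0⇒2^≤ {k} i ≢0 with k <? 2 ^ i
... | yes k<2^i = contradiction (<⇒floorDiv2^≡0 i k<2^i) ≢0
... | no  k≮2^i = ≮⇒≥ k≮2^i

interchange : ∀ a b c d → (a + b) + (c + d) ≡ (a + c) + (b + d)
interchange = solve 4 (λ a b c d → (a :+ b) :+ (c :+ d) := (a :+ c) :+ (b :+ d)) refl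

sumFloor-superadditive : ∀ a b B → sumFloor a B + sumFloor b B ≤ sumFloor (a + b) B
sumFloor-superadditive a b zero    = z≤n
sumFloor-superadditive a b (suc B)
  rewrite interchange (floorDiv2^ a (suc B)) (sumFloor a B) (floorDiv2^ b (suc B)) (sumFloor b B)
  = +-mono-≤ (floorDiv2^-superadditive a b (suc B)) (sumFloor-superadditive a b B)

sumFloor-stable : ∀ k j → sumFloor k (j + k) ≡ s k
sumFloor-stable k zero    = refl
sumFloor-stable k (suc j) = trans (cong (_+ sumFloor k (j + k)) vanishing) (sumFloor-stable k j)
  where
  vanishing : floorDiv2^ k (suc (j + k)) ≡ 0
  vanishing = <⇒floorDiv2^≡0 (suc (j + k)) (<-trans (s≤s (m≤n+m k j)) (n<2^n (suc (j + k))))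

≤+≤-≡⇒≡×≡ : ∀ {x y X Y} → y ≤ x → Y ≤ X → x + X ≡ y + Y → x ≡ y × X ≡ Y
≤+≤-≡⇒≡×≡ y≤x Y≤X eq with m≤n⇒m<n∨m≡n y≤x | m≤n⇒m<n∨m≡n Y≤X
... | _        | inj₁ Y<X = contradiction (sym eq) (<⇒≢ (+-mono-≤-< y≤x Y<X))
... | inj₁ y<x | _        = contradiction (sym eq) (<⇒≢ (+-mono-<-≤ y<x Y≤X))
... | inj₂ y≡x | inj₂ Y≡X = sym y≡x , sym Y≡X

sumFloor-additive⇒floorDiv2^-additive : ∀ a b B → sumFloor (a + b) B ≡ sumFloor a B + sumFloor b B →
  ∀ i → 1 ≤ i → i ≤ B → floorDiv2^ (a + b) i ≡ floorDiv2^ a i + floorDiv2^ b i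
sumFloor-additive⇒floorDiv2^-additive a b zero _ i 1≤i i≤0 = contradiction i≤0 (<⇒≱ 1≤i)
sumFloor-additive⇒floorDiv2^-additive a b (suc B) eq i 1≤i i≤1+B
  with ≤+≤-≡⇒≡×≡ (floorDiv2^-superadditive a b (suc B)) (sumFloor-superadditive a b B)
         (trans eq (interchange (floorDiv2^ a (suc B)) (sumFloor a B) (floorDiv2^ b (suc B)) (sumFloor b B)))
... | top , rest with m≤n⇒m<n∨m≡n i≤1+B
...   | inj₂ refl       = top
...   | inj₁ (s≤s i≤B) = sumFloor-additive⇒floorDiv2^-additive a b B rest i 1≤i i≤B

NoCarry : ℕ → ℕ → Set
NoCarry m n = ∀ i → 1 ≤ i → floorDiv2^ (m + n) i ≡ floorDiv2^ m i + floorDiv2^ n i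

s-additive⇒NoCarry : ∀ m n → s (m + n) ≡ s m + s n → NoCarry m n
s-additive⇒NoCarry m n s-additive i 1≤i with i ≤? m + n
... | yes i≤m+n = sumFloor-additive⇒floorDiv2^-additive m n (m + n) sums i 1≤i i≤m+n
  where
  sums : sumFloor (m + n) (m + n) ≡ sumFloor m (m + n) + sumFloor n (m + n)
  sums = trans s-additive (sym (cong₂ _+_ (trans (cong (sumFloor m) (+-comm m n)) (sumFloor-stable m n))
                                          (sumFloor-stable n m)))
... | no i≰m+n = trans (vanishing (m + n) ≤-refl)
                   (sym (cong₂ _+_ (vanishing m (m≤m+n m n)) (vanishing n (m≤n+m n m))))
  where
  vanishing : ∀ k → k ≤ m + n → floorDiv2^ k i ≡ 0
  vanishing k k≤m+n = <⇒floorDiv2^≡0 i (<-trans (≤-<-trans k≤m+n (≰⇒> i≰m+n)) (n<2^n i))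

NoCarry-<2^ : ∀ {m n} → NoCarry m n → ∀ i → 1 ≤ i → m < 2 ^ i → n < 2 ^ i → m + n < 2 ^ i
NoCarry-<2^ noCarry i 1≤i m<2^i n<2^i = floorDiv2^≡0⇒< i
  (trans (noCarry i 1≤i) (cong₂ _+_ (<⇒floorDiv2^≡0 i m<2^i) (<⇒floorDiv2^≡0 i n<2^i)))

NoCarry-2^≤ : ∀ {m n} → NoCarry m n → m ≤ n → ∀ i → 2 ^ i ≤ m → 2 ^ suc i ≤ n
NoCarry-2^≤ {m} {n} noCarry m≤n i 2^i≤m with n <? 2 ^ suc i
... | no  n≮2^[1+i] = ≮⇒≥ n≮2^[1+i]
... | yes n<2^[1+i] = contradiction 2^[1+i]≤m+n
        (<⇒≱ (NoCarry-<2^ noCarry (suc i) (s≤s z≤n) (≤-<-trans m≤n n<2^[1+i]) n<2^[1+i]))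
  where
  2^[1+i]≤m+n : 2 ^ suc i ≤ m + n
  2^[1+i]≤m+n rewrite 2^[1+n]≡2^n+2^n i = +-mono-≤ 2^i≤m (≤-trans 2^i≤m m≤n)

lemma2p2 : (m n : ℕ) → 1 ≤ m → 1 ≤ n → s (m + n) ≡ s m + s n → m ≤ n →
    ((i : ℕ) → 1 ≤ i → floorDiv2^ m i ≢ 0 → floorDiv2^ n (i + 1) ≢ 0)
    × (m < n)
    × ((t : ℕ) → 1 ≤ t → floorDiv2^ (m + n) t ≢ 0 → n ≥ 2 ^ t)
lemma2p2 m n 1≤m _ s-additive m≤n = no-overtaking , m<n , n-large
  where
  noCarry : NoCarry m n
  noCarry = s-additive⇒NoCarry m n s-additive

  no-overtaking : (i : ℕ) → 1 ≤ i → floorDiv2^ m i ≢ 0 → floorDiv2^ n (i + 1) ≢ 0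
  no-overtaking i _ m/2^i≢0 n/2^[i+1]≡0 rewrite +-comm i 1 =
    <⇒≱ (floorDiv2^≡0⇒< (suc i) n/2^[i+1]≡0)
        (NoCarry-2^≤ noCarry m≤n i (floorDiv2^≢0⇒2^≤ i m/2^i≢0))

  m<n : m < n
  m<n with binary-magnitude m 1≤m
  ... | t , 2^t≤m , m<2^[1+t] = <-≤-trans m<2^[1+t] (NoCarry-2^≤ noCarry m≤n t 2^t≤m)

  n-large : (t : ℕ) → 1 ≤ t → floorDiv2^ (m + n) t ≢ 0 → n ≥ 2 ^ t
  n-large t 1≤t [m+n]/2^t≢0 with n <? 2 ^ t
  ... | no  n≮2^t = ≮⇒≥ n≮2^t
  ... | yes n<2^t = contradiction (<⇒floorDiv2^≡0 t (NoCarry-<2^ noCarry t 1≤t (≤-<-trans m≤n n<2^t) n<2^t))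
                      [m+n]/2^t≢0
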